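{- Let $A_n$ be the number of tilings of an $n$-board by half-squares, fences and combs (so $A_0=1$), and set $A_n=0$ for $n<0$. Let $\mu_l$ be the number of mixed metatiles of length $l$. Then for all non-negative integers $n$, \[A_n=\delta_{n,0}+A_{n-1}+3A_{n-2}+9A_{n-3}+\sum_{l=4}^n\mu_lA_{n-l}.\]
   Context: $\delta_{i,j}$ is $1$ if $i=j$ and $0$ otherwise. An $n$-board is a linear array of $n$ unit cells, each split into a left and a right slot of size $\frac12\times1$. A $(\frac12,\frac12;m)$-comb is a tile of $m$ teeth of size $\frac12\times1$ with consecutive teeth separated by gaps of size $\frac12\times1$; on a board it covers $m$ slots of the same kind (all left or all right) in $m$ consecutive cells, its gaps may be filled by other tiles. Half-squares, fences, combs are the cases $m=1,2,3$. A tiling covers each slot by exactly one tooth. A metatile of length $l$ is a tiling of an $l$-board such that for every $1\le j\le l-1$ some tile has teeth both in cells $1,\dots,j$ and in cells $j+1,\dots,l$. A metatile is mixed if it contains more than one of the three tile types. -}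

module Defs where

open import Data.Nat using (ℕ; zero; suc; _+_; _*_; _∸_; _≤_; _<_; _≡ᵇ_)
open import Data.Integer using (ℤ; +_; -[1+_])
open import Data.Fin using (Fin; toℕ)
open import Data.Vec using (Vec; lookup)
open import Data.List using (List; length; map; applyUpTo)
open import Data.Nat.ListAction using (sum)
open import Data.List.Relation.Unary.Unique.Propositional using (Unique)
open import Data.List.Membership.Propositional using (_∈_)
open import Data.Product using (_×_; proj₁; proj₂; ∃-syntax)
open import Data.Bool using (if_then_else_)
open import Relation.Binary.PropositionalEquality using (_≡_; _≢_)
open import Relation.Nullary using (¬_)

δ : ℕ → ℕ → ℕ
δ i j = if i ≡ᵇ j then 1 else 0

extℤ : (ℕ → ℕ) → ℤ → ℕ
extℤ A (+ k)      = A k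
extℤ A -[1+ k ]   = 0

-- Σ_{l=a}^{b} f l   (empty, i.e. 0, when b < a)
sumFromTo : ℕ → ℕ → (ℕ → ℕ) → ℕ
sumFromTo a b f = sum (map f (applyUpTo (λ i → a + i) (suc b ∸ a)))

NumberOf : {X : Set} → (X → Set) → ℕ → Set
NumberOf {X} P k =
  ∃[ xs ] (Unique xs × (∀ (x : X) → (x ∈ xs → P x) × (P x → x ∈ xs)) × length xs ≡ k)

data Side : Set where
  left right : Side

-- The tooth of a tile occupying a slot: which tile type
-- (half-square = 1 tooth, fence = 2 teeth, comb = 3 teeth)
-- and which of its teeth (0-based, from left to right).
data Tooth : Set where
  half  : Tooth
  fence : Fin 2 → Tooth
  comb  : Fin 3 → Tooth

size : Tooth → ℕ
size half      = 1
size (fence _) = 2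
size (comb _)  = 3

idx : Tooth → ℕ
idx half      = 0
idx (fence i) = toℕ i
idx (comb i)  = toℕ i

-- A labelling of an n-board: for each cell (0-based) the teeth in its
-- left and right slot.
Labelling : ℕ → Set
Labelling n = Vec (Tooth × Tooth) n

slot : {n : ℕ} → Labelling n → Fin n → Side → Tooth
slot v c left  = proj₁ (lookup v c)
slot v c right = proj₂ (lookup v c)

-- The labelling comes from a tiling: tooth i of an m-tooth tile in a slot
-- of cell c is followed (if i+1 < m) by tooth i+1 of the same kind of tile in
-- the same-side slot of cell c+1, and preceded (if i > 0) by tooth i-1 of the
-- same kind of tile in the same-side slot of cell c-1.  Hence the slots are
-- partitioned into tiles, each tile of m teeth covering slots of one side in
-- m consecutive cells, every slot covered by exactly one tooth.
IsTiling : {n : ℕ} → Labelling n → Set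
IsTiling {n} v = ∀ (c : Fin n) (s : Side) →
  ((suc (idx (slot v c s)) < size (slot v c s) →
     ∃[ c' ] (toℕ c' ≡ suc (toℕ c)
              × size (slot v c' s) ≡ size (slot v c s)
              × idx (slot v c' s) ≡ suc (idx (slot v c s))))
  × (0 < idx (slot v c s) →
     ∃[ c' ] (suc (toℕ c') ≡ toℕ c
              × size (slot v c' s) ≡ size (slot v c s)
              × suc (idx (slot v c' s)) ≡ idx (slot v c s))))

Tiling : (n : ℕ) → Labelling n → Set
Tiling n v = IsTiling v

firstCell lastCell : {n : ℕ} → Labelling n → Fin n → Side → ℕ
firstCell v c s = toℕ c ∸ idx (slot v c s)
lastCell  v c s = firstCell v c s + (size (slot v c s) ∸ 1)

-- Metatile of length l: a tiling such that for every 1 ≤ j ≤ l-1 some tile has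
-- teeth both in cells 1..j and in cells j+1..l (1-based), i.e. its first
-- 0-based cell is < j and its last 0-based cell is ≥ j.
Metatile : (l : ℕ) → Labelling l → Set
Metatile l v = Tiling l v ×
  (∀ (j : ℕ) → 1 ≤ j → j < l →
     ∃[ c ] ∃[ s ] (firstCell v c s < j × j ≤ lastCell v c s))

-- Mixed: more than one of the three tile types occurs.
Mixed : {l : ℕ} → Labelling l → Set
Mixed v = ∃[ c ] ∃[ s ] ∃[ c' ] ∃[ s' ] (size (slot v c s) ≢ size (slot v c' s'))

MixedMetatile : (l : ℕ) → Labelling l → Set
MixedMetatile l v = Metatile l v × Mixed v

-- A side of a board, read from left to right, is a sequence of whole tiles (a row), and a
-- labelling is a tiling exactly when both of its sides are rows. A tile crosses the boundary
-- in front of cell j iff the tooth in cell j is not the first tooth of its tile, so a tiling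
-- is a metatile iff every cell but the first holds a non-first tooth on some side. Cutting a
-- tiling of length n ≥ 1 in front of the first later cell holding two first teeth splits it
-- uniquely into a metatile of length l and a tiling of length n − l; hence
-- A_n = Σ_{l=1}^{n} M_l A_{n−l}, where M_l counts all metatiles of length l. Enumeration gives
-- M_1 = 1, M_2 = 3, M_3 = 9, and a finite check of the first four cells shows that every
-- metatile of length at least 4 is mixed, so M_l = μ_l for l ≥ 4.

module Submission where

open import Defs
open import Data.Nat using (ℕ; zero; suc; s≤s⁻¹; _+_; _*_; _∸_; _≤_; _<_; z≤n; s≤s; _≟_; _<?_)
open import Data.Nat.Properties
  using (suc-injective; <-irrefl; <-trans; ≤-refl; ≤-trans; <⇒≤; <⇒≢; n≤1+n; n<1+n; n≤0⇒n≡0; ≮⇒≥; 1+n≢0;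
         +-identityʳ; +-suc; +-assoc; *-identityˡ; +-monoʳ-<; +-monoʳ-≤; +-cancelʳ-≤; +-cancelʳ-≡; m≤n+m;
         m+n∸n≡m; m+n∸m≡n; m+[n∸m]≡n; m∸n+n≡m; m<n⇒0<n∸m; ∸-monoˡ-≤; ∸-monoʳ-<; module ≤-Reasoning)
open import Data.Integer using (_⊖_)
import Data.Integer as ℤ
open import Data.Fin using (Fin; zero; suc; toℕ; fromℕ<; _↑ˡ_)
open import Data.Fin.Properties using (toℕ-injective; toℕ<n; toℕ-fromℕ<; any?)
open import Data.Vec using (Vec; []; _∷_; lookup; map; zip; _++_)
open import Data.Vec.Properties using (lookup-map; ∷-injective; map-proj₁-zip; map-proj₂-zip; lookup-++ˡ)
import Data.Vec.Relation.Unary.All as VecAll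
open import Data.Vec.Relation.Unary.All.Properties using (lookup⁺; lookup⁻; ++ˡ⁻)
open import Data.List.Properties using (length-++; length-map; map-cong; map-cong-local)
open import Data.List.Membership.Propositional.Properties.WithK using (unique∧set⇒bag)
open import Data.List.Relation.Binary.BagAndSetEquality using (∼bag⇒↭)
open import Data.List.Relation.Binary.Permutation.Propositional.Properties using (↭-length)
open import Data.Nat.ListAction using (sum)
import Data.List as List
open import Data.List using (List; []; _∷_; length; filter; cartesianProductWith; concatMap; applyUpTo)
open import Data.List.Membership.Propositional using (_∈_; find; lose)
open import Data.List.Membership.Propositional.Properties
  using (∈-cartesianProductWith⁺; ∈-cartesianProductWith⁻; ∈-filter⁺; ∈-filter⁻;
         ∈-concatMap⁺; ∈-concatMap⁻; ∈-applyUpTo⁺; ∈-applyUpTo⁻)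
open import Data.List.Relation.Unary.Any using (here; there)
import Data.List.Relation.Unary.All as All
open All using (All; []; _∷_)
import Data.List.Relation.Unary.All.Properties as Allₚ
import Data.List.Relation.Unary.AllPairs.Properties as AllPairsₚ
open import Data.List.Relation.Binary.Disjoint.Propositional using (Disjoint)
open import Data.List.Relation.Unary.AllPairs as AllPairs using ()
open import Data.List.Relation.Unary.Unique.Propositional using (Unique)
open import Data.List.Relation.Unary.Unique.Propositional.Properties using (cartesianProductWith⁺; filter⁺; concat⁺)
open import Data.Product using (∃; ∃-syntax; _×_; _,_; proj₁; proj₂)
open import Data.Sum using (_⊎_; inj₁; inj₂)
open import Data.Empty using (⊥-elim)
open import Data.Unit using (⊤; tt)
open import Function using (_∘_; _⇔_; mk⇔; Equivalence)
open import Function.Construct.Identity using (⇔-id)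
open import Function.Construct.Symmetry using (⇔-sym)
open import Relation.Nullary using (¬_; Dec; yes; no)
open import Relation.Nullary.Decidable using (_×-dec_; _⊎-dec_; _→-dec_; ¬?; map′; toWitness)
open import Relation.Unary using (Decidable)
open import Relation.Binary.PropositionalEquality
  using (_≡_; _≢_; refl; sym; trans; cong; cong₂; subst; subst₂; module ≡-Reasoning)

open Equivalence using (to; from)

-- For l ≤ n this is p ++ s, typed so that the length of the suffix is n ∸ l.
joinAt : ∀ {A : Set} {n} l → Vec A l → Vec A (n ∸ l) → Vec A n
joinAt {n = zero}  l       p       s = []
joinAt {n = suc n} zero    []      s = s
joinAt {n = suc n} (suc l) (x ∷ p) s = x ∷ joinAt {n = n} l p s

joinAt-injective : ∀ {A : Set} {n} l → l ≤ n → {p q : Vec A l} {s t : Vec A (n ∸ l)} →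
                   joinAt {n = n} l p s ≡ joinAt l q t → p ≡ q × s ≡ t
joinAt-injective {n = zero}  zero    _        {[]}    {[]}    {[]} {[]} _ = refl , refl
joinAt-injective {n = suc n} zero    _        {[]}    {[]}    eq = refl , eq
joinAt-injective {n = suc n} (suc l) (s≤s l≤n) {x ∷ p} {y ∷ q} eq with ∷-injective eq
... | refl , eq′ with joinAt-injective l l≤n eq′
... | refl , refl = refl , refl

map-joinAt : ∀ {A B : Set} (f : A → B) {n} l (p : Vec A l) (s : Vec A (n ∸ l)) →
             map f (joinAt {n = n} l p s) ≡ joinAt {n = n} l (map f p) (map f s)
map-joinAt f {zero}  l       p       s = refl
map-joinAt f {suc n} zero    []      s = refl
map-joinAt f {suc n} (suc l) (x ∷ p) s = cong (f x ∷_) (map-joinAt f l p s)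

zip-injective : ∀ {A B : Set} {n} {a b : Vec A n} {c d : Vec B n} → zip a c ≡ zip b d → a ≡ b × c ≡ d
zip-injective {a = a} {b} {c} {d} eq =
  trans (sym (map-proj₁-zip a c)) (trans (cong (map proj₁) eq) (map-proj₁-zip b d)) ,
  trans (sym (map-proj₂-zip a c)) (trans (cong (map proj₂) eq) (map-proj₂-zip b d))

zip-map-proj : ∀ {A B : Set} {n} (v : Vec (A × B) n) → zip (map proj₁ v) (map proj₂ v) ≡ v
zip-map-proj []      = refl
zip-map-proj (x ∷ v) = cong (x ∷_) (zip-map-proj v)

length-concatMap : ∀ {A B : Set} (f : A → List B) xs → length (concatMap f xs) ≡ sum (List.map (length ∘ f) xs)
length-concatMap f []       = refl
length-concatMap f (x ∷ xs) = trans (length-++ (f x)) (cong (length (f x) +_) (length-concatMap f xs))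

length-cartesianProductWith : ∀ {A B C : Set} (f : A → B → C) xs ys →
                              length (cartesianProductWith f xs ys) ≡ length xs * length ys
length-cartesianProductWith f []       ys = refl
length-cartesianProductWith f (x ∷ xs) ys =
  trans (length-++ (List.map (f x) ys)) (cong₂ _+_ (length-map (f x) ys) (length-cartesianProductWith f xs ys))

NumberOf-unique : ∀ {X : Set} {P Q : X → Set} {a b} → (∀ x → P x ⇔ Q x) → NumberOf P a → NumberOf Q b → a ≡ b
NumberOf-unique P⇔Q (xs , xs-unique , xs-exact , refl) (ys , ys-unique , ys-exact , refl) =
  ↭-length (∼bag⇒↭ (unique∧set⇒bag xs-unique ys-unique (mk⇔
    (λ x∈xs → proj₂ (ys-exact _) (to (P⇔Q _) (proj₁ (xs-exact _) x∈xs)))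
    (λ x∈ys → proj₂ (xs-exact _) (from (P⇔Q _) (proj₁ (ys-exact _) x∈ys))))))

numberOf-length : ∀ {X : Set} {P : X → Set} {xs} → Unique xs → (∀ x → x ∈ xs ⇔ P x) → NumberOf P (length xs)
numberOf-length {xs = xs} xs-unique exact = xs , xs-unique , (λ x → to (exact x) , from (exact x)) , refl

extℤ-cong : ∀ {f g : ℕ → ℕ} → (∀ n → f n ≡ g n) → ∀ z → extℤ f z ≡ extℤ g z
extℤ-cong f≡g (ℤ.+ n)    = f≡g n
extℤ-cong f≡g ℤ.-[1+ n ] = refl

sumFromTo-cong : ∀ a b {f g : ℕ → ℕ} → (∀ i → f (a + i) ≡ g (a + i)) → sumFromTo a b f ≡ sumFromTo a b g
sumFromTo-cong a b f≡g = cong sum (map-cong-local (Allₚ.applyUpTo⁺₂ (a +_) (suc b ∸ a) f≡g))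

idx<size : ∀ t → idx t < size t
idx<size half                    = s≤s z≤n
idx<size (fence zero)            = s≤s z≤n
idx<size (fence (suc zero))      = s≤s (s≤s z≤n)
idx<size (comb zero)             = s≤s z≤n
idx<size (comb (suc zero))       = s≤s (s≤s z≤n)
idx<size (comb (suc (suc zero)))  = s≤s (s≤s (s≤s z≤n))

0<size : ∀ t → 0 < size t
0<size half      = s≤s z≤n
0<size (fence _) = s≤s z≤n
0<size (comb _)  = s≤s z≤n

teeth : List Tooth
teeth = half ∷ fence zero ∷ fence (suc zero) ∷ comb zero ∷ comb (suc zero) ∷ comb (suc (suc zero)) ∷ []

∈-teeth : ∀ t → t ∈ teeth
∈-teeth half                    = here refl
∈-teeth (fence zero)            = there (here refl)
∈-teeth (fence (suc zero))      = there (there (here refl))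
∈-teeth (comb zero)             = there (there (there (here refl)))
∈-teeth (comb (suc zero))       = there (there (there (there (here refl))))
∈-teeth (comb (suc (suc zero))) = there (there (there (there (there (here refl)))))

teeth-unique : Unique teeth
teeth-unique =
  ((λ ()) ∷ (λ ()) ∷ (λ ()) ∷ (λ ()) ∷ (λ ()) ∷ []) AllPairs.∷
  ((λ ()) ∷ (λ ()) ∷ (λ ()) ∷ (λ ()) ∷ []) AllPairs.∷
  ((λ ()) ∷ (λ ()) ∷ (λ ()) ∷ []) AllPairs.∷
  ((λ ()) ∷ (λ ()) ∷ []) AllPairs.∷
  ((λ ()) ∷ []) AllPairs.∷
  ([] AllPairs.∷ AllPairs.[])

vectors : ∀ n → List (Vec Tooth n)
vectors zero    = [] ∷ []
vectors (suc n) = cartesianProductWith _∷_ teeth (vectors n)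

∈-vectors : ∀ {n} (w : Vec Tooth n) → w ∈ vectors n
∈-vectors []       = here refl
∈-vectors (t ∷ ts) = ∈-cartesianProductWith⁺ _∷_ (∈-teeth t) (∈-vectors ts)

vectors-unique : ∀ n → Unique (vectors n)
vectors-unique zero    = [] AllPairs.∷ AllPairs.[]
vectors-unique (suc n) = cartesianProductWith⁺ _∷_ ∷-injective teeth-unique (vectors-unique n)

Starts Ends : Tooth → Set
Starts t = idx t ≡ 0
Ends t = ¬ suc (idx t) < size t

-- The two clauses of IsTiling for a tooth t in the next cell after p, on the same side.
FollowsForward FollowsBackward Follows : Tooth → Tooth → Set
FollowsForward p t = suc (idx p) < size p → size t ≡ size p × idx t ≡ suc (idx p)
FollowsBackward p t = 0 < idx t → size p ≡ size t × suc (idx p) ≡ idx t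
Follows p t = FollowsForward p t × FollowsBackward p t

starts? : ∀ t → Dec (Starts t)
starts? t = idx t ≟ 0

ends? : ∀ t → Dec (Ends t)
ends? t = ¬? (suc (idx t) <? size t)

follows? : ∀ p t → Dec (Follows p t)
follows? p t = (suc (idx p) <? size p →-dec (size t ≟ size p ×-dec idx t ≟ suc (idx p)))
         ×-dec (0 <? idx t →-dec (size p ≟ size t ×-dec suc (idx p) ≟ idx t))

RowFrom : ∀ {n} → Tooth → Vec Tooth n → Set
RowFrom p []       = Ends p
RowFrom p (t ∷ ts) = Follows p t × RowFrom t ts

Row : ∀ {n} → Vec Tooth n → Set
Row []       = ⊤
Row (t ∷ ts) = Starts t × RowFrom t ts

rowFrom? : ∀ {n} p (w : Vec Tooth n) → Dec (RowFrom p w)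
rowFrom? p []       = ends? p
rowFrom? p (t ∷ ts) = follows? p t ×-dec rowFrom? t ts

row? : ∀ {n} → Decidable (Row {n})
row? []       = yes tt
row? (t ∷ ts) = starts? t ×-dec rowFrom? t ts

RowPrefixFrom : ∀ {n} → Tooth → Vec Tooth n → Set
RowPrefixFrom p []       = ⊤
RowPrefixFrom p (t ∷ ts) = Follows p t × RowPrefixFrom t ts

RowPrefix : ∀ {n} → Vec Tooth n → Set
RowPrefix []       = ⊤
RowPrefix (t ∷ ts) = Starts t × RowPrefixFrom t ts

rowPrefixFrom? : ∀ {n} p (w : Vec Tooth n) → Dec (RowPrefixFrom p w)
rowPrefixFrom? p []       = yes tt
rowPrefixFrom? p (t ∷ ts) = follows? p t ×-dec rowPrefixFrom? t ts

rowPrefix? : ∀ {n} → Decidable (RowPrefix {n})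
rowPrefix? []       = yes tt
rowPrefix? (t ∷ ts) = starts? t ×-dec rowPrefixFrom? t ts

rowFrom-++⇒rowPrefixFrom : ∀ {m n} p (xs : Vec Tooth m) {ys : Vec Tooth n} → RowFrom p (xs ++ ys) → RowPrefixFrom p xs
rowFrom-++⇒rowPrefixFrom p []       _              = tt
rowFrom-++⇒rowPrefixFrom p (t ∷ ts) (follows , rest) = follows , rowFrom-++⇒rowPrefixFrom t ts rest

row-++⇒rowPrefix : ∀ {m n} (xs : Vec Tooth m) {ys : Vec Tooth n} → Row (xs ++ ys) → RowPrefix xs
row-++⇒rowPrefix []       _              = tt
row-++⇒rowPrefix (t ∷ ts) (start , rest) = start , rowFrom-++⇒rowPrefixFrom t ts rest

module _ {n : ℕ} (g : Fin n → Tooth) where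

  ForwardLinked BackwardLinked : Fin n → Set
  ForwardLinked c = suc (idx (g c)) < size (g c) →
    ∃[ c′ ] (toℕ c′ ≡ suc (toℕ c) × size (g c′) ≡ size (g c) × idx (g c′) ≡ suc (idx (g c)))
  BackwardLinked c = 0 < idx (g c) →
    ∃[ c′ ] (suc (toℕ c′) ≡ toℕ c × size (g c′) ≡ size (g c) × suc (idx (g c′)) ≡ idx (g c))

  Linked : Set
  Linked = ∀ c → ForwardLinked c × BackwardLinked c

isTiling⇒linked : ∀ {n} {v : Labelling n} → IsTiling v → ∀ s → Linked (λ c → slot v c s)
isTiling⇒linked t s c = t c s

linked⇒isTiling : ∀ {n} {v : Labelling n} → (∀ s → Linked (λ c → slot v c s)) → IsTiling v
linked⇒isTiling l c s = l s c

Linked-cong : ∀ {n} {g h : Fin n → Tooth} → (∀ c → g c ≡ h c) → Linked g → Linked h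
Linked-cong {g = g} {h} g≡h linked c = forward , backward
  where
  forward : ForwardLinked h c
  forward lt with proj₁ (linked c) (subst (λ t → suc (idx t) < size t) (sym (g≡h c)) lt)
  ... | c′ , pos , eqs =
    c′ , pos , subst₂ (λ a b → size a ≡ size b × idx a ≡ suc (idx b)) (g≡h c′) (g≡h c) eqs
  backward : BackwardLinked h c
  backward lt with proj₂ (linked c) (subst (λ t → 0 < idx t) (sym (g≡h c)) lt)
  ... | c′ , pos , eqs =
    c′ , pos , subst₂ (λ a b → size a ≡ size b × suc (idx a) ≡ idx b) (g≡h c′) (g≡h c) eqs

module _ {n : ℕ} (g : Fin (suc n) → Tooth) where

  LinkedFrom : Set
  LinkedFrom = (∀ c → ForwardLinked g c) × (∀ c → BackwardLinked g (suc c))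

  backwardLinked-zero : BackwardLinked g zero ⇔ Starts (g zero)
  backwardLinked-zero = mk⇔ (λ h → n≤0⇒n≡0 (≮⇒≥ (λ pos → 1+n≢0 (proj₁ (proj₂ (h pos))))))
                            (λ start pos → ⊥-elim (<-irrefl (sym start) pos))

  forwardLinked-suc : ∀ c → ForwardLinked g (suc c) ⇔ ForwardLinked (g ∘ suc) c
  forwardLinked-suc c = mk⇔ down up
    where
    down : ForwardLinked g (suc c) → ForwardLinked (g ∘ suc) c
    down h lt with h lt
    ... | suc c′ , pos , eqs = c′ , suc-injective pos , eqs
    up : ForwardLinked (g ∘ suc) c → ForwardLinked g (suc c)
    up h lt with h lt
    ... | c′ , pos , eqs = suc c′ , cong suc pos , eqs

forwardLinked-last : (g : Fin 1 → Tooth) → ForwardLinked g zero ⇔ Ends (g zero)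
forwardLinked-last g = mk⇔ (λ h lt → <-irrefl (proj₁ (proj₂ (h lt))) (toℕ<n (proj₁ (h lt))))
                           (λ end lt → ⊥-elim (end lt))

module _ {n : ℕ} (g : Fin (suc (suc n)) → Tooth) where

  forwardLinked-zero : ForwardLinked g zero ⇔ FollowsForward (g zero) (g (suc zero))
  forwardLinked-zero = mk⇔ linked⇒follows (λ f lt → suc zero , refl , f lt)
    where
    linked⇒follows : ForwardLinked g zero → FollowsForward (g zero) (g (suc zero))
    linked⇒follows h lt with h lt
    ... | suc zero , _ , eqs = eqs

  backwardLinked-one : BackwardLinked g (suc zero) ⇔ FollowsBackward (g zero) (g (suc zero))
  backwardLinked-one = mk⇔ linked⇒follows (λ f lt → zero , refl , f lt)
    where
    linked⇒follows : BackwardLinked g (suc zero) → FollowsBackward (g zero) (g (suc zero))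
    linked⇒follows h lt with h lt
    ... | zero , _ , eqs = eqs

  backwardLinked-suc : ∀ c → BackwardLinked g (suc (suc c)) ⇔ BackwardLinked (g ∘ suc) (suc c)
  backwardLinked-suc c = mk⇔ down up
    where
    down : BackwardLinked g (suc (suc c)) → BackwardLinked (g ∘ suc) (suc c)
    down h lt with h lt
    ... | suc c′ , pos , eqs = c′ , suc-injective pos , eqs
    up : BackwardLinked (g ∘ suc) (suc c) → BackwardLinked g (suc (suc c))
    up h lt with h lt
    ... | c′ , pos , eqs = suc c′ , cong suc pos , eqs

rowFrom⇔linkedFrom : ∀ {n} p (w : Vec Tooth n) → RowFrom p w ⇔ LinkedFrom (lookup (p ∷ w))
rowFrom⇔linkedFrom p [] = mk⇔
  (λ end → (λ { zero → from (forwardLinked-last g) end }) , λ ())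
  (λ (forward , _) → to (forwardLinked-last g) (forward zero))
  where
  g : Fin 1 → Tooth
  g = lookup (p ∷ [])
rowFrom⇔linkedFrom {suc n} p (t ∷ ts) = mk⇔
  (λ ((ff , fb) , rest) → let (forward , backward) = to ih rest in
     (λ { zero → from (forwardLinked-zero g) ff ; (suc c) → from (forwardLinked-suc g c) (forward c) }) ,
     (λ { zero → from (backwardLinked-one g) fb ; (suc c) → from (backwardLinked-suc g c) (backward c) }))
  (λ (forward , backward) →
     (to (forwardLinked-zero g) (forward zero) , to (backwardLinked-one g) (backward zero)) ,
     from ih ((λ c → to (forwardLinked-suc g c) (forward (suc c))) ,
              (λ c → to (backwardLinked-suc g c) (backward (suc c)))))
  where
  g : Fin (suc (suc n)) → Tooth
  g = lookup (p ∷ t ∷ ts)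
  ih = rowFrom⇔linkedFrom t ts

row⇔linked : ∀ {n} (w : Vec Tooth n) → Row w ⇔ Linked (lookup w)
row⇔linked [] = mk⇔ (λ _ ()) (λ _ → tt)
row⇔linked {suc n} (t ∷ ts) = mk⇔
  (λ (start , rest) → let (forward , backward) = to (rowFrom⇔linkedFrom t ts) rest in
     λ { zero → forward zero , from (backwardLinked-zero g) start
       ; (suc c) → forward (suc c) , backward c })
  (λ linked → to (backwardLinked-zero g) (proj₂ (linked zero)) ,
              from (rowFrom⇔linkedFrom t ts) ((λ c → proj₁ (linked c)) , (λ c → proj₂ (linked (suc c)))))
  where
  g : Fin (suc n) → Tooth
  g = lookup (t ∷ ts)

Tiles : ∀ {n} → Labelling n → Set
Tiles v = Row (map proj₁ v) × Row (map proj₂ v)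

isTiling⇔tiles : ∀ {n} (v : Labelling n) → IsTiling v ⇔ Tiles v
isTiling⇔tiles v = mk⇔
  (λ t → from (row⇔linked _) (Linked-cong (λ c → sym (lookup-map c proj₁ v)) (isTiling⇒linked t left)) ,
         from (row⇔linked _) (Linked-cong (λ c → sym (lookup-map c proj₂ v)) (isTiling⇒linked t right)))
  (λ (row₁ , row₂) → linked⇒isTiling λ
     { left  → Linked-cong (λ c → lookup-map c proj₁ v) (to (row⇔linked _) row₁)
     ; right → Linked-cong (λ c → lookup-map c proj₂ v) (to (row⇔linked _) row₂) })

tileStart tileEnd : ∀ {n} → (Fin n → Tooth) → Fin n → ℕ
tileStart g c = toℕ c ∸ idx (g c)
tileEnd g c = tileStart g c + (size (g c) ∸ 1)

Crosses : ∀ {n} → (Fin n → Tooth) → Fin n → ℕ → Set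
Crosses g c j = tileStart g c < j × j ≤ tileEnd g c

module _ {n : ℕ} {g : Fin n → Tooth} (linked : Linked g) where

  toothAhead : ∀ k c → idx (g c) + k < size (g c) →
    ∃[ d ] (toℕ d ≡ toℕ c + k × size (g d) ≡ size (g c) × idx (g d) ≡ idx (g c) + k)
  toothAhead zero c _ = c , sym (+-identityʳ _) , refl , sym (+-identityʳ _)
  toothAhead (suc k) c lt
    with toothAhead k c (<-trans (+-monoʳ-< (idx (g c)) (n<1+n k)) lt)
  ... | d , pos , sz , i
    with proj₁ (linked d) (subst₂ _<_ (trans (+-suc (idx (g c)) k) (cong suc (sym i))) (sym sz) lt)
  ... | d′ , pos′ , sz′ , i′ =
    d′ , trans pos′ (trans (cong suc pos) (sym (+-suc _ k))) , trans sz′ sz ,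
    trans i′ (trans (cong suc i) (sym (+-suc _ k)))

  toothBehind : ∀ k c → k ≤ idx (g c) →
    ∃[ d ] (toℕ d + k ≡ toℕ c × size (g d) ≡ size (g c) × idx (g d) + k ≡ idx (g c))
  toothBehind zero c _ = c , +-identityʳ _ , refl , +-identityʳ _
  toothBehind (suc k) c le with toothBehind k c (≤-trans (n≤1+n k) le)
  ... | d , pos , sz , i
    with proj₂ (linked d) (+-cancelʳ-≤ k 1 (idx (g d)) (subst (suc k ≤_) (sym i) le))
  ... | d′ , pos′ , sz′ , i′ =
    d′ , trans (+-suc _ k) (trans (cong (_+ k) pos′) pos) , trans sz′ sz ,
    trans (+-suc _ k) (trans (cong (_+ k) i′) i)

  firstTooth : ∀ c → ∃[ d ] (toℕ d ≡ tileStart g c × size (g d) ≡ size (g c) × idx (g d) ≡ 0)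
  firstTooth c with toothBehind (idx (g c)) c ≤-refl
  ... | d , pos , sz , i =
    d , trans (sym (m+n∸n≡m (toℕ d) (idx (g c)))) (cong (_∸ idx (g c)) pos) , sz ,
    +-cancelʳ-≡ (idx (g c)) (idx (g d)) 0 i

  idx≤toℕ : ∀ c → idx (g c) ≤ toℕ c
  idx≤toℕ c with toothBehind (idx (g c)) c ≤-refl
  ... | d , pos , _ = subst (idx (g c) ≤_) pos (m≤n+m (idx (g c)) (toℕ d))

  toothAtOffset : ∀ d₀ d → idx (g d₀) ≡ 0 → toℕ d₀ ≤ toℕ d → toℕ d ∸ toℕ d₀ < size (g d₀) →
                  idx (g d) ≡ toℕ d ∸ toℕ d₀
  toothAtOffset d₀ d i₀ d₀≤d offset<size
    with toothAhead (toℕ d ∸ toℕ d₀) d₀ (subst (λ i → i + (toℕ d ∸ toℕ d₀) < size (g d₀)) (sym i₀) offset<size)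
  ... | d₁ , pos , _ , i₁ with toℕ-injective (trans pos (m+[n∸m]≡n d₀≤d))
  ... | refl = trans i₁ (cong (_+ (toℕ d ∸ toℕ d₀)) i₀)

  crosses⇒0<idx : ∀ c d → Crosses g c (toℕ d) → 0 < idx (g d)
  crosses⇒0<idx c d (start<d , d≤end) with firstTooth c
  ... | d₀ , d₀≡start , sz , i₀ =
    subst (0 <_) (sym (toothAtOffset d₀ d i₀ (<⇒≤ d₀<d) offset<size)) (m<n⇒0<n∸m d₀<d)
    where
    d₀<d : toℕ d₀ < toℕ d
    d₀<d = subst (_< toℕ d) (sym d₀≡start) start<d
    offset<size : toℕ d ∸ toℕ d₀ < size (g d₀)
    offset<size = subst (toℕ d ∸ toℕ d₀ <_) (sym sz) (begin-strict
      toℕ d ∸ toℕ d₀                      ≤⟨ ∸-monoˡ-≤ (toℕ d₀) (subst (λ x → toℕ d ≤ x + _) (sym d₀≡start) d≤end) ⟩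
      toℕ d₀ + (size (g c) ∸ 1) ∸ toℕ d₀  ≡⟨ m+n∸m≡n (toℕ d₀) _ ⟩
      size (g c) ∸ 1                      <⟨ ∸-monoʳ-< (s≤s z≤n) (0<size (g c)) ⟩
      size (g c)                          ∎)
      where open ≤-Reasoning

  0<idx⇒crosses : ∀ c → 0 < idx (g c) → Crosses g c (toℕ c)
  0<idx⇒crosses c pos =
    ∸-monoʳ-< pos (idx≤toℕ c) ,
    subst (_≤ tileEnd g c) (m∸n+n≡m (idx≤toℕ c)) (+-monoʳ-≤ (tileStart g c) (∸-monoˡ-≤ 1 (idx<size (g c))))

Crossed Break : Tooth × Tooth → Set
Crossed (a , b) = 0 < idx a ⊎ 0 < idx b
Break (a , b) = Starts a × Starts b

crossed? : ∀ x → Dec (Crossed x)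
crossed? (a , b) = 0 <? idx a ⊎-dec 0 <? idx b

Unbroken : ∀ {n} → Labelling n → Set
Unbroken []       = ⊤
Unbroken (_ ∷ xs) = VecAll.All Crossed xs

unbroken? : ∀ {n} → Decidable (Unbroken {n})
unbroken? []       = yes tt
unbroken? (_ ∷ xs) = VecAll.all? crossed? xs

metatile⇔isTiling×unbroken : ∀ {l} (v : Labelling l) → Metatile l v ⇔ (IsTiling v × Unbroken v)
metatile⇔isTiling×unbroken [] = mk⇔ (λ (t , _) → t , tt) (λ (t , _) → t , λ _ _ ())
metatile⇔isTiling×unbroken {suc l} (x ∷ xs) = mk⇔
  (λ (t , crossings) → t , lookup⁻ (λ i → crossed t (crossings (suc (toℕ i)) (s≤s z≤n) (s≤s (toℕ<n i)))))
  (λ (t , unbroken) → t , crossing t unbroken)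
  where
  v : Labelling (suc l)
  v = x ∷ xs
  CrossingAt : ℕ → Set
  CrossingAt j = ∃[ c ] ∃[ s ] Crosses (λ c → slot v c s) c j
  crossed : IsTiling v → ∀ {i} → CrossingAt (toℕ (suc i)) → Crossed (lookup xs i)
  crossed t {i} (c , left  , crosses) = inj₁ (crosses⇒0<idx (isTiling⇒linked t left) c (suc i) crosses)
  crossed t {i} (c , right , crosses) = inj₂ (crosses⇒0<idx (isTiling⇒linked t right) c (suc i) crosses)
  crossingAt : IsTiling v → ∀ i → Crossed (lookup xs i) → CrossingAt (toℕ (suc i))
  crossingAt t i (inj₁ pos) = suc i , left  , 0<idx⇒crosses (isTiling⇒linked t left) (suc i) pos
  crossingAt t i (inj₂ pos) = suc i , right , 0<idx⇒crosses (isTiling⇒linked t right) (suc i) pos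
  crossing : IsTiling v → Unbroken v → ∀ j → 1 ≤ j → j < suc l → CrossingAt j
  crossing t unbroken (suc j) _ j<l =
    subst CrossingAt (cong suc (toℕ-fromℕ< (s≤s⁻¹ j<l))) (crossingAt t i (lookup⁺ unbroken i))
    where i = fromℕ< (s≤s⁻¹ j<l)

metatile⇔tiles×unbroken : ∀ {l} (v : Labelling l) → Metatile l v ⇔ (Tiles v × Unbroken v)
metatile⇔tiles×unbroken v = mk⇔
  (λ metatile → let (tiling , unbroken) = to (metatile⇔isTiling×unbroken v) metatile in
                to (isTiling⇔tiles v) tiling , unbroken)
  (λ (tiles , unbroken) → from (metatile⇔isTiling×unbroken v) (from (isTiling⇔tiles v) tiles , unbroken))

-- Cutting a tiling at its first break

StartsHead : ∀ {n} → Vec Tooth n → Set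
StartsHead []      = ⊤
StartsHead (t ∷ _) = Starts t

BreakHead : ∀ {n} → Labelling n → Set
BreakHead []      = ⊤
BreakHead (x ∷ _) = Break x

follows⇔ends : ∀ {p t} → Starts t → Follows p t ⇔ Ends p
follows⇔ends start = mk⇔
  (λ (forward , _) lt → 1+n≢0 (trans (sym (proj₂ (forward lt))) start))
  (λ end → (λ lt → ⊥-elim (end lt)) , (λ pos → ⊥-elim (<-irrefl (sym start) pos)))

rowFrom-joinAt : ∀ {n} l → l ≤ n → ∀ q (a : Vec Tooth l) (b : Vec Tooth (n ∸ l)) → StartsHead b →
                 RowFrom q (joinAt {n = n} l a b) ⇔ (RowFrom q a × Row b)
rowFrom-joinAt {zero} zero _ q [] [] _ = mk⇔ (_, tt) proj₁
rowFrom-joinAt {suc n} zero _ q [] (t ∷ ts) start = mk⇔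
  (λ (follows , rest) → to (follows⇔ends start) follows , start , rest)
  (λ (end , _ , rest) → from (follows⇔ends start) end , rest)
rowFrom-joinAt {suc n} (suc l) (s≤s l≤n) q (t ∷ a) b start = mk⇔
  (λ (follows , rest) → let (rowa , rowb) = to ih rest in (follows , rowa) , rowb)
  (λ ((follows , rowa) , rowb) → follows , from ih (rowa , rowb))
  where ih = rowFrom-joinAt l l≤n t a b start

row-joinAt : ∀ {n} l → suc l ≤ n → (a : Vec Tooth (suc l)) (b : Vec Tooth (n ∸ suc l)) → StartsHead b →
             Row (joinAt {n = n} (suc l) a b) ⇔ (Row a × Row b)
row-joinAt {suc n} l (s≤s l≤n) (t ∷ a) b start = mk⇔
  (λ (s , rest) → let (rowa , rowb) = to ih rest in (s , rowa) , rowb)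
  (λ ((s , rowa) , rowb) → s , from ih (rowa , rowb))
  where ih = rowFrom-joinAt l l≤n t a b start

breakHead⇒startsHeads : ∀ {n} (s : Labelling n) → BreakHead s → StartsHead (map proj₁ s) × StartsHead (map proj₂ s)
breakHead⇒startsHeads []      _ = tt , tt
breakHead⇒startsHeads (_ ∷ _) b = b

tiles-joinAt : ∀ {n} l → suc l ≤ n → (p : Labelling (suc l)) (s : Labelling (n ∸ suc l)) → BreakHead s →
               Tiles (joinAt {n = n} (suc l) p s) ⇔ (Tiles p × Tiles s)
tiles-joinAt {n} l l<n p s breakHead
  rewrite map-joinAt proj₁ {n} (suc l) p s | map-joinAt proj₂ {n} (suc l) p s = mk⇔
  (λ (row₁ , row₂) → let (p₁ , s₁) = to rows₁ row₁ ; (p₂ , s₂) = to rows₂ row₂ in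
                      (p₁ , p₂) , (s₁ , s₂))
  (λ ((p₁ , p₂) , (s₁ , s₂)) → from rows₁ (p₁ , s₁) , from rows₂ (p₂ , s₂))
  where
  heads = breakHead⇒startsHeads s breakHead
  rows₁ = row-joinAt l l<n (map proj₁ p) (map proj₁ s) (proj₁ heads)
  rows₂ = row-joinAt l l<n (map proj₂ p) (map proj₂ s) (proj₂ heads)

tiles⇒breakHead : ∀ {n} (v : Labelling n) → Tiles v → BreakHead v
tiles⇒breakHead []      _                               = tt
tiles⇒breakHead (_ ∷ _) ((start₁ , _) , (start₂ , _)) = start₁ , start₂

¬crossed⇒break : ∀ x → ¬ Crossed x → Break x
¬crossed⇒break (a , b) ¬crossed = n≤0⇒n≡0 (≮⇒≥ (¬crossed ∘ inj₁)) , n≤0⇒n≡0 (≮⇒≥ (¬crossed ∘ inj₂))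

crossed⇒¬break : ∀ x → Crossed x → ¬ Break x
crossed⇒¬break (a , b) (inj₁ pos) (start , _) = <-irrefl (sym start) pos
crossed⇒¬break (a , b) (inj₂ pos) (_ , start) = <-irrefl (sym start) pos

data FirstBreak {n : ℕ} : Labelling n → Set where
  split : ∀ {l} → l ≤ n → (p : Labelling l) (s : Labelling (n ∸ l)) →
          VecAll.All Crossed p → BreakHead s → FirstBreak (joinAt l p s)

firstBreak : ∀ {n} (v : Labelling n) → FirstBreak v
firstBreak [] = split z≤n [] [] VecAll.[] tt
firstBreak (x ∷ xs) with crossed? x
... | no ¬crossed = split z≤n [] (x ∷ xs) VecAll.[] (¬crossed⇒break x ¬crossed)
... | yes crossed with firstBreak xs
...   | split l≤n p s crossings breakHead = split (s≤s l≤n) (x ∷ p) s (crossed VecAll.∷ crossings) breakHead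

firstBreak-unique : ∀ {n l l′} → l ≤ n → l′ ≤ n →
                    {p : Labelling l} {s : Labelling (n ∸ l)} {p′ : Labelling l′} {s′ : Labelling (n ∸ l′)} →
                    VecAll.All Crossed p → BreakHead s → VecAll.All Crossed p′ → BreakHead s′ →
                    joinAt {n = n} l p s ≡ joinAt l′ p′ s′ → l ≡ l′
firstBreak-unique {zero} z≤n z≤n _ _ _ _ _ = refl
firstBreak-unique {suc n} z≤n z≤n _ _ _ _ _ = refl
firstBreak-unique {suc n} z≤n (s≤s _) {p = []} {s = y ∷ _} {p′ = x ∷ _} _ breakHead (crossed VecAll.∷ _) _ eq
  with refl ← proj₁ (∷-injective eq) = ⊥-elim (crossed⇒¬break x crossed breakHead)
firstBreak-unique {suc n} (s≤s _) z≤n {p = x ∷ _} {p′ = []} {s′ = y ∷ _} (crossed VecAll.∷ _) _ _ breakHead eq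
  with refl ← proj₁ (∷-injective eq) = ⊥-elim (crossed⇒¬break x crossed breakHead)
firstBreak-unique {suc n} (s≤s l≤n) (s≤s l′≤n) {p = _ ∷ _} {p′ = _ ∷ _}
                  (_ VecAll.∷ crossings) breakHead (_ VecAll.∷ crossings′) breakHead′ eq =
  cong suc (firstBreak-unique l≤n l′≤n crossings breakHead crossings′ breakHead′ (proj₂ (∷-injective eq)))

leadingMetatile-unique : ∀ {n l l′} → suc l ≤ n → suc l′ ≤ n →
                         {p : Labelling (suc l)} {s : Labelling (n ∸ suc l)}
                         {p′ : Labelling (suc l′)} {s′ : Labelling (n ∸ suc l′)} →
                         Unbroken p → BreakHead s → Unbroken p′ → BreakHead s′ →
                         joinAt {n = n} (suc l) p s ≡ joinAt (suc l′) p′ s′ → l ≡ l′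
leadingMetatile-unique {suc n} (s≤s l≤n) (s≤s l′≤n) {_ ∷ _} {_} {_ ∷ _}
                       unbroken breakHead unbroken′ breakHead′ eq =
  firstBreak-unique l≤n l′≤n unbroken breakHead unbroken′ breakHead′ (proj₂ (∷-injective eq))

module _ {n : ℕ} {R : Vec Tooth n → Set} (R? : Decidable R) where

  withRows : List (Labelling n)
  withRows = cartesianProductWith zip (filter R? (vectors n)) (filter R? (vectors n))

  ∈-withRows : ∀ v → v ∈ withRows ⇔ (R (map proj₁ v) × R (map proj₂ v))
  ∈-withRows v = mk⇔ members (λ (r₁ , r₂) → subst (_∈ withRows) (zip-map-proj v)
                                  (∈-cartesianProductWith⁺ zip (∈-filter⁺ R? (∈-vectors _) r₁)
                                                               (∈-filter⁺ R? (∈-vectors _) r₂)))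
    where
    members : v ∈ withRows → R (map proj₁ v) × R (map proj₂ v)
    members m with ∈-cartesianProductWith⁻ zip (filter R? (vectors n)) (filter R? (vectors n)) m
    ... | a , b , a∈ , b∈ , refl =
      subst R (sym (map-proj₁-zip a b)) (proj₂ (∈-filter⁻ R? {xs = vectors n} a∈)) ,
      subst R (sym (map-proj₂-zip a b)) (proj₂ (∈-filter⁻ R? {xs = vectors n} b∈))

  withRows-unique : Unique withRows
  withRows-unique = cartesianProductWith⁺ zip zip-injective (filter⁺ R? (vectors-unique n)) (filter⁺ R? (vectors-unique n))

tilings metatiles : ∀ n → List (Labelling n)
tilings n = withRows (row? {n})
metatiles n = filter unbroken? (tilings n)

tilingCount metatileCount : ℕ → ℕ
tilingCount n = length (tilings n)
metatileCount n = length (metatiles n)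

∈-metatiles : ∀ {n} (v : Labelling n) → v ∈ metatiles n ⇔ (Tiles v × Unbroken v)
∈-metatiles v = mk⇔
  (λ m → let (m′ , unbroken) = ∈-filter⁻ unbroken? {xs = tilings _} m in to (∈-withRows row? v) m′ , unbroken)
  (λ (tiles , unbroken) → ∈-filter⁺ unbroken? (from (∈-withRows row? v) tiles) unbroken)

metatiles-unique : ∀ n → Unique (metatiles n)
metatiles-unique n = filter⁺ unbroken? (withRows-unique row?)

countTilings : ∀ n → NumberOf Tiles (tilingCount n)
countTilings n = numberOf-length (withRows-unique (row? {n})) (∈-withRows row?)

countMetatiles : ∀ n → NumberOf (λ v → Tiles v × Unbroken v) (metatileCount n)
countMetatiles n = numberOf-length (metatiles-unique n) ∈-metatiles

-- Counting tilings by their leading metatile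

block : ∀ n l → List (Labelling n)
block n l = cartesianProductWith (joinAt l) (metatiles l) (tilings (n ∸ l))

decomposition : ∀ n → List (Labelling n)
decomposition n = concatMap (block n) (applyUpTo suc n)

∈-block⁻ : ∀ {n i v} → v ∈ block n (suc i) →
           ∃[ p ] ∃[ s ] (v ≡ joinAt (suc i) p s × (Tiles p × Unbroken p) × Tiles s)
∈-block⁻ {n} {i} v∈ with ∈-cartesianProductWith⁻ (joinAt (suc i)) (metatiles (suc i)) (tilings (n ∸ suc i)) v∈
... | p , s , p∈ , s∈ , refl = p , s , refl , to (∈-metatiles p) p∈ , to (∈-withRows row? s) s∈

∈-decomposition⁻ : ∀ {n} (v : Labelling n) → v ∈ decomposition n → Tiles v
∈-decomposition⁻ {n} v v∈ with find (∈-concatMap⁻ (block n) {xs = applyUpTo suc n} v∈)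
... | l , l∈ , v∈block with ∈-applyUpTo⁻ suc l∈
... | i , i<n , refl with ∈-block⁻ {i = i} v∈block
... | p , s , refl , (tiles-p , _) , tiles-s =
  from (tiles-joinAt i i<n p s (tiles⇒breakHead s tiles-s)) (tiles-p , tiles-s)

∈-decomposition⁺ : ∀ {n} (v : Labelling (suc n)) → Tiles v → v ∈ decomposition (suc n)
∈-decomposition⁺ {n} (x ∷ xs) tiles with firstBreak xs
... | split {l} l≤n p s crossings breakHead =
  ∈-concatMap⁺ (block (suc n)) (lose (∈-applyUpTo⁺ suc (s≤s l≤n)) v∈block)
  where
  parts : Tiles (x ∷ p) × Tiles s
  parts = to (tiles-joinAt l (s≤s l≤n) (x ∷ p) s breakHead) tiles
  v∈block : x ∷ joinAt l p s ∈ block (suc n) (suc l)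
  v∈block = ∈-cartesianProductWith⁺ (joinAt (suc l)) (from (∈-metatiles (x ∷ p)) (proj₁ parts , crossings))
                                                     (from (∈-withRows row? s) (proj₂ parts))

decomposition-unique : ∀ n → Unique (decomposition n)
decomposition-unique n =
  concat⁺ (Allₚ.map⁺ (Allₚ.applyUpTo⁺₁ suc n block-unique))
          (AllPairsₚ.map⁺ (AllPairsₚ.applyUpTo⁺₁ suc n disjoint))
  where
  block-unique : ∀ {i} → i < n → Unique (block n (suc i))
  block-unique i<n = cartesianProductWith⁺ (joinAt (suc _)) (joinAt-injective (suc _) i<n)
                                           (metatiles-unique _) (withRows-unique row?)
  disjoint : ∀ {i j} → i < j → j < n → Disjoint (block n (suc i)) (block n (suc j))
  disjoint {i} {j} i<j j<n (v∈i , v∈j) with ∈-block⁻ {i = i} v∈i | ∈-block⁻ {i = j} v∈j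
  ... | p , s , refl , (_ , unbroken) , tiles | p′ , s′ , eq , (_ , unbroken′) , tiles′ =
    <⇒≢ i<j (leadingMetatile-unique (<-trans i<j j<n) j<n unbroken (tiles⇒breakHead s tiles)
                                    unbroken′ (tiles⇒breakHead s′ tiles′) eq)

length-decomposition : ∀ n → length (decomposition n) ≡
                              sum (List.map (λ l → metatileCount l * tilingCount (n ∸ l)) (applyUpTo suc n))
length-decomposition n =
  trans (length-concatMap (block n) (applyUpTo suc n))
        (cong sum (map-cong (λ l → length-cartesianProductWith (joinAt l) (metatiles l) (tilings (n ∸ l)))
                            (applyUpTo suc n)))

tilingCount-convolution : ∀ n → tilingCount (suc n) ≡
                                 sum (List.map (λ l → metatileCount l * tilingCount (suc n ∸ l)) (applyUpTo suc (suc n)))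
tilingCount-convolution n =
  trans (NumberOf-unique (λ _ → ⇔-id _)
                         (countTilings (suc n))
                         (numberOf-length (decomposition-unique (suc n))
                                          (λ v → mk⇔ (∈-decomposition⁻ v) (∈-decomposition⁺ v))))
        (length-decomposition (suc n))

-- Metatiles of length at least four are mixed

anySide? : ∀ {P : Side → Set} → Decidable P → Dec (∃ P)
anySide? P? = map′ (λ { (inj₁ p) → left , p ; (inj₂ p) → right , p })
                   (λ { (left , p) → inj₁ p ; (right , p) → inj₂ p })
                   (P? left ⊎-dec P? right)

mixed? : ∀ {n} (v : Labelling n) → Dec (Mixed v)
mixed? v = any? λ c → anySide? λ s → any? λ c′ → anySide? λ s′ →
             ¬? (size (slot v c s) ≟ size (slot v c′ s′))

slot-++ : ∀ {m n} (u : Labelling m) (w : Labelling n) c s → slot (u ++ w) (c ↑ˡ n) s ≡ slot u c s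
slot-++ u w c left  = cong proj₁ (lookup-++ˡ u w c)
slot-++ u w c right = cong proj₂ (lookup-++ˡ u w c)

mixed-++ : ∀ {m n} (u : Labelling m) (w : Labelling n) → Mixed u → Mixed (u ++ w)
mixed-++ {n = n} u w (c , s , c′ , s′ , sizes≢) =
  c ↑ˡ n , s , c′ ↑ˡ n , s′ ,
  subst₂ (λ a b → size a ≢ size b) (sym (slot-++ u w c s)) (sym (slot-++ u w c′ s′)) sizes≢

metatilePrefixes : List (Labelling 4)
metatilePrefixes = filter unbroken? (withRows rowPrefix?)

metatilePrefixes-mixed : All Mixed metatilePrefixes
metatilePrefixes-mixed = toWitness {a? = All.all? mixed? metatilePrefixes} tt

longMetatile-mixed : ∀ {k} (v : Labelling (4 + k)) → Tiles v → Unbroken v → Mixed v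
longMetatile-mixed (x₀ ∷ x₁ ∷ x₂ ∷ x₃ ∷ w) (row₁ , row₂) unbroken =
  mixed-++ u w (All.lookup metatilePrefixes-mixed u∈)
  where
  u : Labelling 4
  u = x₀ ∷ x₁ ∷ x₂ ∷ x₃ ∷ []
  u∈ : u ∈ metatilePrefixes
  u∈ = ∈-filter⁺ unbroken?
         (from (∈-withRows rowPrefix? u) (row-++⇒rowPrefix (map proj₁ u) row₁ ,
                                          row-++⇒rowPrefix (map proj₂ u) row₂))
         (++ˡ⁻ (x₁ ∷ x₂ ∷ x₃ ∷ []) unbroken)

longMixedMetatile⇔tiles×unbroken : ∀ k (v : Labelling (4 + k)) → MixedMetatile (4 + k) v ⇔ (Tiles v × Unbroken v)
longMixedMetatile⇔tiles×unbroken k v = mk⇔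
  (to (metatile⇔tiles×unbroken v) ∘ proj₁)
  (λ (tiles , unbroken) → from (metatile⇔tiles×unbroken v) (tiles , unbroken) , longMetatile-mixed v tiles unbroken)

recurrenceRHS : (ℕ → ℕ) → (ℕ → ℕ) → ℕ → ℕ
recurrenceRHS A μ n = δ n 0 + extℤ A (n ⊖ 1) + 3 * extℤ A (n ⊖ 2) + 9 * extℤ A (n ⊖ 3)
                      + sumFromTo 4 n (λ l → μ l * A (n ∸ l))

tilingCount-recurrence : ∀ n → tilingCount n ≡ recurrenceRHS tilingCount metatileCount n
tilingCount-recurrence 0 = refl
tilingCount-recurrence 1 = refl
tilingCount-recurrence 2 = refl
tilingCount-recurrence 3 = refl
-- Here metatileCount 1, 2 and 3 evaluate to 1, 3 and 9.
tilingCount-recurrence (suc (suc (suc (suc k)))) =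
  trans (tilingCount-convolution (3 + k)) (regroup (tilingCount (3 + k)) (tilingCount (2 + k)) (tilingCount (1 + k)) _)
  where
  regroup : ∀ a b c s → 1 * a + (3 * b + (9 * c + s)) ≡ a + 3 * b + 9 * c + s
  regroup a b c s = begin
    1 * a + (3 * b + (9 * c + s)) ≡⟨ cong (_+ (3 * b + (9 * c + s))) (*-identityˡ a) ⟩
    a + (3 * b + (9 * c + s))     ≡⟨ sym (+-assoc a (3 * b) (9 * c + s)) ⟩
    a + 3 * b + (9 * c + s)       ≡⟨ sym (+-assoc (a + 3 * b) (9 * c) s) ⟩
    a + 3 * b + 9 * c + s         ∎
    where open ≡-Reasoning

recurrenceRHS-cong : ∀ {A A′ μ μ′ : ℕ → ℕ} → (∀ n → A n ≡ A′ n) → (∀ k → μ (4 + k) ≡ μ′ (4 + k)) →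
                     ∀ n → recurrenceRHS A μ n ≡ recurrenceRHS A′ μ′ n
recurrenceRHS-cong A≡ μ≡ n =
  cong₂ _+_ (cong₂ _+_ (cong₂ _+_ (cong (δ n 0 +_) (extℤ-cong A≡ (n ⊖ 1)))
                                  (cong (3 *_) (extℤ-cong A≡ (n ⊖ 2))))
                       (cong (9 *_) (extℤ-cong A≡ (n ⊖ 3))))
            (sumFromTo-cong 4 n (λ i → cong₂ _*_ (μ≡ i) (A≡ (n ∸ (4 + i)))))

lemma4 : (A μ : ℕ → ℕ)
         → (∀ n → NumberOf (Tiling n) (A n))
         → (∀ l → NumberOf (MixedMetatile l) (μ l))
         → ∀ (n : ℕ)
         → A n ≡ δ n 0 + extℤ A (n ⊖ 1) + 3 * extℤ A (n ⊖ 2) + 9 * extℤ A (n ⊖ 3)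
                 + sumFromTo 4 n (λ l → μ l * A (n ∸ l))
lemma4 A μ countA countμ n = begin
  A n                                        ≡⟨ sym (tilingCount≡A n) ⟩
  tilingCount n                              ≡⟨ tilingCount-recurrence n ⟩
  recurrenceRHS tilingCount metatileCount n  ≡⟨ recurrenceRHS-cong {μ = metatileCount} {μ′ = μ}
                                                                   tilingCount≡A metatileCount≡μ n ⟩
  recurrenceRHS A μ n                        ∎
  where
  open ≡-Reasoning
  tilingCount≡A : ∀ n → tilingCount n ≡ A n
  tilingCount≡A n = NumberOf-unique (λ v → ⇔-sym (isTiling⇔tiles v)) (countTilings n) (countA n)
  metatileCount≡μ : ∀ k → metatileCount (4 + k) ≡ μ (4 + k)
  metatileCount≡μ k = NumberOf-unique (λ v → ⇔-sym (longMixedMetatile⇔tiles×unbroken k v))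
                                      (countMetatiles (4 + k)) (countμ (4 + k))
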